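{- For integers $n\ge 0$, $s\ge 0$, $j\ge 0$ let $p^{2n}_{s,j}$ denote the number of Dyck paths of length $2n$ that are $j$-ped at level $s$. Then $p^0_{s,0}=1$ and $p^0_{s,j}=0$ for all $s>0$, $j>0$; and for all $s\ge 1$, $n\ge 1$, $j\ge 0$, $$p^{2n}_{s,j}=\sum_{i=0}^{n-1}\sum_{k=0}^{j}p^{2i}_{s-1,k}\,p^{2(n-i-1)}_{s,j-k}.$$
   Context: A Dyck path of length $2n$ is a lattice path from $(0,0)$ to $(2n,0)$ using steps $U=(1,1)$ and $D=(1,-1)$ that never goes below the $x$-axis. A Dyck path has $2n+1$ vertices (including both endpoints). The path is called $j$-ped at level $s$ if exactly $j$ of its vertices have $y$-coordinate $s$. -}

module Defs where

open import Data.Nat using (ℕ; zero; suc; _+_; _*_; _∸_; _≡ᵇ_)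
open import Data.Bool using (Bool; true; false; _∧_; if_then_else_)
open import Data.List using (List; []; _∷_; length; map; filter; concatMap; _++_; sum; upTo)
open import Relation.Binary.PropositionalEquality using (_≡_)
open import Relation.Nullary.Decidable using (Dec; yes; no)

-- Steps of a lattice path: U = (1,1), D = (1,-1).
data Step : Set where
  U D : Step

allWords : ℕ → List (List Step)
allWords zero = [] ∷ []
allWords (suc m) = concatMap (λ w → (U ∷ w) ∷ (D ∷ w) ∷ []) (allWords m)

dyckFrom : ℕ → List Step → Bool
dyckFrom zero [] = true
dyckFrom (suc _) [] = false
dyckFrom h (U ∷ w) = dyckFrom (suc h) w
dyckFrom zero (D ∷ w) = false
dyckFrom (suc h) (D ∷ w) = dyckFrom h w

isDyck : List Step → Bool
isDyck = dyckFrom 0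

heightsFrom : ℕ → List Step → List ℕ
heightsFrom h [] = h ∷ []
heightsFrom h (U ∷ w) = h ∷ heightsFrom (suc h) w
heightsFrom h (D ∷ w) = h ∷ heightsFrom (h ∸ 1) w

verticesAtLevel : ℕ → List Step → ℕ
verticesAtLevel s w = length (filter (λ h → h Data.Nat.≟ s) (heightsFrom 0 w))

dyckPaths : ℕ → List (List Step)
dyckPaths n = filter (λ w → Data.Bool._≟_ (isDyck w) true) (allWords (2 * n))

-- p n s j = number of Dyck paths of length 2n that are j-ped at level s
p : ℕ → ℕ → ℕ → ℕ
p n s j = length (filter (λ w → verticesAtLevel s w Data.Nat.≟ j) (dyckPaths n))

sumBelow : ℕ → (ℕ → ℕ) → ℕ
sumBelow zero f = 0
sumBelow (suc n) f = sumBelow n f + f n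

sumTo : ℕ → (ℕ → ℕ) → ℕ
sumTo n f = sumBelow (suc n) f

module Submission where

-- Every count is rewritten as a weighted sum  Σʷ m F  of a function F over all
-- 2^m step words of length m, with 0/1 weights (indicator of Dyckness times a
-- Kronecker delta on the number of vertices at the level).  For n ≥ 0 every
-- Dyck path of length 2n+2 factors uniquely by its first return to the axis as
-- U a D b with a, b Dyck; the vertices of U a D b at height s+1 are those of a
-- at height s (raised by one) together with those of b at height s+1.
-- Summing over the factorisations of all words (Σʷ-splits) turns the left-hand
-- side into a sum over the length m of a; odd lengths contribute nothing
-- (a Dyck word has even length), and for m = 2i the number of pairs (a, b)
-- whose level counts add up to j is the convolution
--   Σ_k p i s k · p (n-i) (s+1) (j-k),
-- by the sifting property of the Kronecker delta.

open import Defs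
open import Data.Nat using (ℕ; suc; _+_; _*_; _∸_)
open import Data.Product using (_×_)
open import Relation.Binary.PropositionalEquality using (_≡_)

open import Data.Nat using (zero; _≟_; _≤?_; _≤_; _<_; s≤s)
open import Data.Nat.Properties
open import Data.Bool using (Bool; true; false; not)
import Data.Bool as Bool
open import Data.Bool.Properties using (not-involutive)
open import Data.List using (List; []; _∷_; length; map; filter; concatMap; _++_)
open import Data.List.Properties using (length-++; filter-++)
open import Data.Product using (_,_)
open import Relation.Binary.PropositionalEquality
  using (_≢_; refl; sym; trans; cong; cong₂; subst; ≢-sym; module ≡-Reasoning)
open import Relation.Nullary using (does; yes; no)
open import Relation.Nullary.Decidable using (dec-true; dec-false)
open import Relation.Unary using (Decidable)
open import Algebra.Properties.CommutativeSemigroup +-commutativeSemigroup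
  using () renaming (interchange to +-interchange)
open import Algebra.Properties.CommutativeSemigroup *-commutativeSemigroup
  using () renaming (interchange to *-interchange)

open ≡-Reasoning

𝟙 : Bool → ℕ
𝟙 true = 1
𝟙 false = 0

δ : ℕ → ℕ → ℕ
δ x k = 𝟙 (does (x ≟ k))

δ-self : ∀ x → δ x x ≡ 1
δ-self x = cong 𝟙 (dec-true (x ≟ x) refl)

δ-≢ : ∀ {x k} → x ≢ k → δ x k ≡ 0
δ-≢ {x} {k} x≢k = cong 𝟙 (dec-false (x ≟ k) x≢k)

sumBelow-cong : ∀ N {f g : ℕ → ℕ} → (∀ k → f k ≡ g k) → sumBelow N f ≡ sumBelow N g
sumBelow-cong zero e = refl
sumBelow-cong (suc N) e = cong₂ _+_ (sumBelow-cong N e) (e N)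

sumBelow-+ : ∀ N (f g : ℕ → ℕ) →
  sumBelow N (λ k → f k + g k) ≡ sumBelow N f + sumBelow N g
sumBelow-+ zero f g = refl
sumBelow-+ (suc N) f g =
  trans (cong (_+ (f N + g N)) (sumBelow-+ N f g))
        (+-interchange (sumBelow N f) (sumBelow N g) (f N) (g N))

sumBelow-scale : ∀ N c (f : ℕ → ℕ) → sumBelow N (λ k → c * f k) ≡ c * sumBelow N f
sumBelow-scale zero c f = sym (*-zeroʳ c)
sumBelow-scale (suc N) c f =
  trans (cong (_+ c * f N) (sumBelow-scale N c f)) (sym (*-distribˡ-+ c _ _))

sumBelow-head : ∀ N (f : ℕ → ℕ) → sumBelow (suc N) f ≡ f 0 + sumBelow N (λ k → f (suc k))
sumBelow-head zero f = +-comm 0 (f 0)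
sumBelow-head (suc N) f =
  trans (cong (_+ f (suc N)) (sumBelow-head N f)) (+-assoc (f 0) _ _)

sumBelow-evens : ∀ n (f : ℕ → ℕ) → (∀ i → f (suc (2 * i)) ≡ 0) →
  sumBelow (suc (2 * n)) f ≡ sumBelow (suc n) (λ i → f (2 * i))
sumBelow-evens zero f odd = refl
sumBelow-evens (suc n) f odd = begin
  sumBelow (suc (2 * suc n)) f
    ≡⟨ cong (λ t → sumBelow (suc t) f) (*-suc 2 n) ⟩
  (sumBelow (suc (2 * n)) f + f (suc (2 * n))) + f (2 + 2 * n)
    ≡⟨ cong (_+ f (2 + 2 * n)) (trans (cong₂ _+_ (sumBelow-evens n f odd) (odd n)) (+-identityʳ _)) ⟩
  sumBelow (suc n) (λ i → f (2 * i)) + f (2 + 2 * n)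
    ≡⟨ cong (λ t → sumBelow (suc n) (λ i → f (2 * i)) + f t) (sym (*-suc 2 n)) ⟩
  sumBelow (suc (suc n)) (λ i → f (2 * i)) ∎

δ-sift-out : ∀ N x (g : ℕ → ℕ) → N ≤ x → sumBelow N (λ k → δ x k * g k) ≡ 0
δ-sift-out zero x g _ = refl
δ-sift-out (suc N) x g N<x =
  cong₂ _+_ (δ-sift-out N x g (<⇒≤ N<x)) (cong (_* g N) (δ-≢ (≢-sym (<⇒≢ N<x))))

δ-sift : ∀ N x (g : ℕ → ℕ) → x < N → sumBelow N (λ k → δ x k * g k) ≡ g x
δ-sift (suc N) x g (s≤s x≤N) with x ≟ N
... | yes refl =
  trans (cong₂ _+_ (δ-sift-out x x g ≤-refl) (cong (_* g x) (δ-self x))) (+-identityʳ (g x))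
... | no x≢N =
  trans (cong₂ _+_ (δ-sift N x g (≤∧≢⇒< x≤N x≢N)) (cong (_* g N) (δ-≢ x≢N))) (+-identityʳ (g x))

δ-shift : ∀ x y j → x ≤ j → δ (x + y) j ≡ δ y (j ∸ x)
δ-shift zero y j _ = refl
δ-shift (suc x) y (suc j) (s≤s x≤j) = δ-shift x y j x≤j

δ-convolution : ∀ x y j → sumTo j (λ k → δ x k * δ y (j ∸ k)) ≡ δ (x + y) j
δ-convolution x y j with x ≤? j
... | yes x≤j = trans (δ-sift (suc j) x _ (s≤s x≤j)) (sym (δ-shift x y j x≤j))
... | no x≰j = trans (δ-sift-out (suc j) x _ (≰⇒> x≰j))
                     (sym (δ-≢ (λ x+y≡j → x≰j (subst (x ≤_) x+y≡j (m≤m+n x y)))))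

weighted-convolution : ∀ c d x y j →
  sumTo j (λ k → (c * δ x k) * (d * δ y (j ∸ k))) ≡ c * (d * δ (x + y) j)
weighted-convolution c d x y j = begin
  sumTo j (λ k → (c * δ x k) * (d * δ y (j ∸ k)))
    ≡⟨ sumBelow-cong (suc j) (λ k → *-interchange c (δ x k) d (δ y (j ∸ k))) ⟩
  sumTo j (λ k → (c * d) * (δ x k * δ y (j ∸ k)))
    ≡⟨ sumBelow-scale (suc j) (c * d) _ ⟩
  (c * d) * sumTo j (λ k → δ x k * δ y (j ∸ k))
    ≡⟨ cong ((c * d) *_) (δ-convolution x y j) ⟩
  (c * d) * δ (x + y) j
    ≡⟨ *-assoc c d _ ⟩
  c * (d * δ (x + y) j) ∎

-- Σʷ m F = Σ_{w ∈ {U,D}^m} F w, recursing on the first step of w.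
Σʷ : ℕ → (List Step → ℕ) → ℕ
Σʷ zero F = F []
Σʷ (suc m) F = Σʷ m (λ w → F (U ∷ w) + F (D ∷ w))

Σʷ-cong : ∀ m {F G : List Step → ℕ} → (∀ w → F w ≡ G w) → Σʷ m F ≡ Σʷ m G
Σʷ-cong zero e = e []
Σʷ-cong (suc m) e = Σʷ-cong m (λ w → cong₂ _+_ (e (U ∷ w)) (e (D ∷ w)))

Σʷ-+ : ∀ m (F G : List Step → ℕ) → Σʷ m (λ w → F w + G w) ≡ Σʷ m F + Σʷ m G
Σʷ-+ zero F G = refl
Σʷ-+ (suc m) F G =
  trans (Σʷ-cong m (λ w → +-interchange (F (U ∷ w)) (G (U ∷ w)) (F (D ∷ w)) (G (D ∷ w))))
        (Σʷ-+ m _ _)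

Σʷ-scale : ∀ m c (F : List Step → ℕ) → Σʷ m (λ w → c * F w) ≡ c * Σʷ m F
Σʷ-scale zero c F = refl
Σʷ-scale (suc m) c F =
  trans (Σʷ-cong m (λ w → sym (*-distribˡ-+ c (F (U ∷ w)) (F (D ∷ w))))) (Σʷ-scale m c _)

Σʷ-zero : ∀ m → Σʷ m (λ _ → 0) ≡ 0
Σʷ-zero zero = refl
Σʷ-zero (suc m) = Σʷ-zero m

Σʷ-product : ∀ m K (F G : List Step → ℕ) →
  Σʷ m F * Σʷ K G ≡ Σʷ m (λ a → Σʷ K (λ b → F a * G b))
Σʷ-product m K F G = begin
  Σʷ m F * Σʷ K G                       ≡⟨ *-comm (Σʷ m F) (Σʷ K G) ⟩
  Σʷ K G * Σʷ m F                       ≡⟨ sym (Σʷ-scale m (Σʷ K G) F) ⟩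
  Σʷ m (λ a → Σʷ K G * F a)             ≡⟨ Σʷ-cong m (λ a → *-comm (Σʷ K G) (F a)) ⟩
  Σʷ m (λ a → F a * Σʷ K G)             ≡⟨ Σʷ-cong m (λ a → sym (Σʷ-scale K (F a) G)) ⟩
  Σʷ m (λ a → Σʷ K (λ b → F a * G b)) ∎

sumBelow-Σʷ : ∀ N m (g : ℕ → List Step → ℕ) →
  sumBelow N (λ k → Σʷ m (g k)) ≡ Σʷ m (λ w → sumBelow N (λ k → g k w))
sumBelow-Σʷ zero m g = sym (Σʷ-zero m)
sumBelow-Σʷ (suc N) m g =
  trans (cong (_+ Σʷ m (g N)) (sumBelow-Σʷ N m g)) (sym (Σʷ-+ m _ _))

sumOver : {A : Set} → List A → (A → ℕ) → ℕ
sumOver [] F = 0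
sumOver (x ∷ xs) F = F x + sumOver xs F

sumOver-cong : {A : Set} (xs : List A) {F G : A → ℕ} → (∀ x → F x ≡ G x) →
  sumOver xs F ≡ sumOver xs G
sumOver-cong [] e = refl
sumOver-cong (x ∷ xs) e = cong₂ _+_ (e x) (sumOver-cong xs e)

sumOver-++ : {A : Set} (xs ys : List A) (F : A → ℕ) →
  sumOver (xs ++ ys) F ≡ sumOver xs F + sumOver ys F
sumOver-++ [] ys F = refl
sumOver-++ (x ∷ xs) ys F = trans (cong (F x +_) (sumOver-++ xs ys F)) (sym (+-assoc (F x) _ _))

sumOver-concatMap : {A B : Set} (g : A → List B) (xs : List A) (F : B → ℕ) →
  sumOver (concatMap g xs) F ≡ sumOver xs (λ x → sumOver (g x) F)
sumOver-concatMap g [] F = refl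
sumOver-concatMap g (x ∷ xs) F =
  trans (sumOver-++ (g x) (concatMap g xs) F) (cong (sumOver (g x) F +_) (sumOver-concatMap g xs F))

sumOver-allWords : ∀ m (F : List Step → ℕ) → sumOver (allWords m) F ≡ Σʷ m F
sumOver-allWords zero F = +-identityʳ (F [])
sumOver-allWords (suc m) F = begin
  sumOver (concatMap (λ w → (U ∷ w) ∷ (D ∷ w) ∷ []) (allWords m)) F
    ≡⟨ sumOver-concatMap _ (allWords m) F ⟩
  sumOver (allWords m) (λ w → F (U ∷ w) + (F (D ∷ w) + 0))
    ≡⟨ sumOver-cong (allWords m) (λ w → cong (F (U ∷ w) +_) (+-identityʳ (F (D ∷ w)))) ⟩
  sumOver (allWords m) (λ w → F (U ∷ w) + F (D ∷ w))
    ≡⟨ sumOver-allWords m _ ⟩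
  Σʷ (suc m) F ∎

length-filter-filter : {A : Set} {P Q : A → Set} (P? : Decidable P) (Q? : Decidable Q) (xs : List A) →
  length (filter P? (filter Q? xs)) ≡ sumOver xs (λ x → 𝟙 (does (Q? x)) * 𝟙 (does (P? x)))
length-filter-filter P? Q? [] = refl
length-filter-filter P? Q? (x ∷ xs) with does (Q? x)
... | false = length-filter-filter P? Q? xs
... | true with does (P? x)
...   | true = cong suc (length-filter-filter P? Q? xs)
...   | false = length-filter-filter P? Q? xs

𝟙-≟-true : ∀ b → 𝟙 (does (b Bool.≟ true)) ≡ 𝟙 b
𝟙-≟-true true = refl
𝟙-≟-true false = refl

pWeight : ℕ → ℕ → List Step → ℕ
pWeight s k w = 𝟙 (isDyck w) * δ (verticesAtLevel s w) k

p-as-Σʷ : ∀ n s k → p n s k ≡ Σʷ (2 * n) (pWeight s k)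
p-as-Σʷ n s k = begin
  p n s k
    ≡⟨ length-filter-filter (λ w → verticesAtLevel s w ≟ k) (λ w → isDyck w Bool.≟ true) (allWords (2 * n)) ⟩
  sumOver (allWords (2 * n)) (λ w → 𝟙 (does (isDyck w Bool.≟ true)) * δ (verticesAtLevel s w) k)
    ≡⟨ sumOver-cong (allWords (2 * n)) (λ w → cong (_* δ (verticesAtLevel s w) k) (𝟙-≟-true (isDyck w))) ⟩
  sumOver (allWords (2 * n)) (pWeight s k)
    ≡⟨ sumOver-allWords (2 * n) (pWeight s k) ⟩
  Σʷ (2 * n) (pWeight s k) ∎

-- splits c X = Σ X a b over all factorisations c = a ++ D ∷ b.
splits : List Step → (List Step → List Step → ℕ) → ℕ
splits [] X = 0
splits (U ∷ c) X = splits c (λ a b → X (U ∷ a) b)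
splits (D ∷ c) X = X [] c + splits c (λ a b → X (D ∷ a) b)

splits-zero : ∀ c → splits c (λ _ _ → 0) ≡ 0
splits-zero [] = refl
splits-zero (U ∷ c) = splits-zero c
splits-zero (D ∷ c) = splits-zero c

Σʷ-splits : ∀ N X →
  Σʷ N (λ c → splits c X) ≡ sumBelow N (λ m → Σʷ m (λ a → Σʷ (N ∸ suc m) (X a)))
Σʷ-splits zero X = refl
Σʷ-splits (suc N) X = begin
  Σʷ N (λ c → splits c XU + (X [] c + splits c XD))
    ≡⟨ Σʷ-+ N _ _ ⟩
  Σʷ N (λ c → splits c XU) + Σʷ N (λ c → X [] c + splits c XD)
    ≡⟨ cong (Σʷ N (λ c → splits c XU) +_) (Σʷ-+ N _ _) ⟩
  Σʷ N (λ c → splits c XU) + (Σʷ N (X []) + Σʷ N (λ c → splits c XD))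
    ≡⟨ cong₂ (λ u v → u + (Σʷ N (X []) + v)) (Σʷ-splits N XU) (Σʷ-splits N XD) ⟩
  A + (Σʷ N (X []) + C)
    ≡⟨ trans (sym (+-assoc A _ C)) (cong (_+ C) (+-comm A _)) ⟩
  (Σʷ N (X []) + A) + C
    ≡⟨ trans (+-assoc (Σʷ N (X [])) A C) (cong (Σʷ N (X []) +_) (sym (sumBelow-+ N _ _))) ⟩
  Σʷ N (X []) + sumBelow N (λ m → Σʷ m (λ a → Σʷ (N ∸ suc m) (XU a)) + Σʷ m (λ a → Σʷ (N ∸ suc m) (XD a)))
    ≡⟨ cong (Σʷ N (X []) +_) (sumBelow-cong N (λ m → sym (Σʷ-+ m _ _))) ⟩
  Σʷ N (X []) + sumBelow N (λ m → Σʷ (suc m) (λ a → Σʷ (N ∸ suc m) (X a)))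
    ≡⟨ sym (sumBelow-head N _) ⟩
  sumBelow (suc N) (λ m → Σʷ m (λ a → Σʷ (suc N ∸ suc m) (X a))) ∎
  where
  XU XD : List Step → List Step → ℕ
  XU a b = X (U ∷ a) b
  XD a b = X (D ∷ a) b
  A C : ℕ
  A = sumBelow N (λ m → Σʷ m (λ a → Σʷ (N ∸ suc m) (XU a)))
  C = sumBelow N (λ m → Σʷ m (λ a → Σʷ (N ∸ suc m) (XD a)))

-- A path c from height r+1 down to 0 (never below 0) splits uniquely at the
-- step where it first reaches height 0: c = a ++ D ∷ b, where a runs from r+1
-- to 1 staying ≥ 1 (a path from r to 0 read one level lower) and b is Dyck.
firstDescent : ∀ r c (G : List Step → ℕ) →
  𝟙 (dyckFrom (suc r) c) * G c
    ≡ splits c (λ a b → 𝟙 (dyckFrom r a) * (𝟙 (dyckFrom 0 b) * G (a ++ D ∷ b)))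
firstDescent r [] G = refl
firstDescent zero (U ∷ c) G = firstDescent 1 c (λ w → G (U ∷ w))
firstDescent (suc r) (U ∷ c) G = firstDescent (suc (suc r)) c (λ w → G (U ∷ w))
firstDescent zero (D ∷ c) G = sym (trans (cong₂ _+_ (+-identityʳ _) (splits-zero c)) (+-identityʳ _))
firstDescent (suc r) (D ∷ c) G = firstDescent r c (λ w → G (D ∷ w))

count : ℕ → List ℕ → ℕ
count s xs = length (filter (_≟ s) xs)

count-++ : ∀ s xs ys → count s (xs ++ ys) ≡ count s xs + count s ys
count-++ s xs ys = trans (cong length (filter-++ (_≟ s) xs ys)) (length-++ (filter (_≟ s) xs))

count-map-suc : ∀ s xs → count (suc s) (map suc xs) ≡ count s xs
count-map-suc s [] = refl
count-map-suc s (x ∷ xs) with does (x ≟ s)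
... | true = cong suc (count-map-suc s xs)
... | false = count-map-suc s xs

heights-after-return : ∀ h a b → dyckFrom h a ≡ true →
  heightsFrom (suc h) (a ++ D ∷ b) ≡ map suc (heightsFrom h a) ++ heightsFrom 0 b
heights-after-return zero [] b _ = refl
heights-after-return zero (U ∷ a) b d = cong (1 ∷_) (heights-after-return 1 a b d)
heights-after-return (suc h) (U ∷ a) b d = cong (suc (suc h) ∷_) (heights-after-return (suc (suc h)) a b d)
heights-after-return (suc h) (D ∷ a) b d = cong (suc (suc h) ∷_) (heights-after-return h a b d)

level-after-return : ∀ s a b → isDyck a ≡ true →
  verticesAtLevel (suc s) (U ∷ a ++ D ∷ b) ≡ verticesAtLevel s a + verticesAtLevel (suc s) b
level-after-return s a b dyck = begin
  count (suc s) (heightsFrom 1 (a ++ D ∷ b))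
    ≡⟨ cong (count (suc s)) (heights-after-return 0 a b dyck) ⟩
  count (suc s) (map suc (heightsFrom 0 a) ++ heightsFrom 0 b)
    ≡⟨ count-++ (suc s) (map suc (heightsFrom 0 a)) (heightsFrom 0 b) ⟩
  count (suc s) (map suc (heightsFrom 0 a)) + count (suc s) (heightsFrom 0 b)
    ≡⟨ cong (_+ count (suc s) (heightsFrom 0 b)) (count-map-suc s (heightsFrom 0 a)) ⟩
  count s (heightsFrom 0 a) + count (suc s) (heightsFrom 0 b) ∎

isEven : ℕ → Bool
isEven zero = true
isEven (suc n) = not (isEven n)

isEven-double : ∀ i → isEven (2 * i) ≡ true
isEven-double zero = refl
isEven-double (suc i) =
  subst (λ t → isEven t ≡ true) (sym (*-suc 2 i)) (trans (not-involutive _) (isEven-double i))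

-- A path from height h to 0 has length of the parity of h, so words of length m
-- of the other parity carry no weight.
Σʷ-parity-vanish : ∀ m h (G : List Step → ℕ) → isEven m ≡ not (isEven h) →
  Σʷ m (λ a → 𝟙 (dyckFrom h a) * G a) ≡ 0
Σʷ-parity-vanish zero zero G ()
Σʷ-parity-vanish zero (suc h) G _ = refl
Σʷ-parity-vanish (suc m) zero G par =
  trans (Σʷ-+ m _ _) (cong₂ _+_ (Σʷ-parity-vanish m 1 (λ w → G (U ∷ w)) par′) (Σʷ-zero m))
  where
  par′ : isEven m ≡ true
  par′ = trans (sym (not-involutive _)) (cong not par)
Σʷ-parity-vanish (suc m) (suc h) G par =
  trans (Σʷ-+ m _ _)
        (cong₂ _+_ (Σʷ-parity-vanish m (suc (suc h)) (λ w → G (U ∷ w)) par′)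
                   (Σʷ-parity-vanish m h (λ w → G (D ∷ w)) par″))
  where
  par″ : isEven m ≡ not (isEven h)
  par″ = trans (sym (not-involutive _)) (trans (cong not par) (not-involutive _))
  par′ : isEven m ≡ not (not (not (isEven h)))
  par′ = trans par″ (cong not (sym (not-involutive _)))

module Recurrence (s j : ℕ) where

  pairsWith : ℕ → List Step → ℕ
  pairsWith K a = Σʷ K (λ b → 𝟙 (isDyck b) * δ (verticesAtLevel s a + verticesAtLevel (suc s) b) j)

  pairCount : ℕ → ℕ → ℕ
  pairCount m K = Σʷ m (λ a → 𝟙 (isDyck a) * pairsWith K a)

  decomposed-weight : ∀ a b →
    𝟙 (isDyck a) * (𝟙 (isDyck b) * δ (verticesAtLevel (suc s) (U ∷ a ++ D ∷ b)) j)
      ≡ 𝟙 (isDyck a) * (𝟙 (isDyck b) * δ (verticesAtLevel s a + verticesAtLevel (suc s) b) j)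
  decomposed-weight a b with isDyck a in dyck
  ... | false = refl
  ... | true = cong (λ x → 1 * (𝟙 (isDyck b) * δ x j)) (level-after-return s a b dyck)

  lhs : ∀ n → p (suc n) (suc s) j ≡ sumBelow (suc n) (λ i → pairCount (2 * i) (2 * n ∸ 2 * i))
  lhs n = begin
    p (suc n) (suc s) j
      ≡⟨ p-as-Σʷ (suc n) (suc s) j ⟩
    Σʷ (2 * suc n) (pWeight (suc s) j)
      ≡⟨ cong (λ t → Σʷ t (pWeight (suc s) j)) (*-suc 2 n) ⟩
    Σʷ (suc (2 * n)) (λ c → pWeight (suc s) j (U ∷ c) + 0)
      ≡⟨ Σʷ-cong (suc (2 * n)) (λ c → trans (+-identityʳ _) (firstDescent 0 c G)) ⟩
    Σʷ (suc (2 * n)) (λ c → splits c X)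
      ≡⟨ Σʷ-splits (suc (2 * n)) X ⟩
    sumBelow (suc (2 * n)) (λ m → Σʷ m (λ a → Σʷ (2 * n ∸ m) (X a)))
      ≡⟨ sumBelow-cong (suc (2 * n)) (λ m → Σʷ-cong m (λ a →
           trans (Σʷ-cong (2 * n ∸ m) (decomposed-weight a)) (Σʷ-scale (2 * n ∸ m) (𝟙 (isDyck a)) _))) ⟩
    sumBelow (suc (2 * n)) (λ m → pairCount m (2 * n ∸ m))
      ≡⟨ sumBelow-evens n (λ m → pairCount m (2 * n ∸ m))
           (λ i → Σʷ-parity-vanish (suc (2 * i)) 0 (pairsWith (2 * n ∸ suc (2 * i)))
                  (cong not (isEven-double i))) ⟩
    sumBelow (suc n) (λ i → pairCount (2 * i) (2 * n ∸ 2 * i)) ∎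
    where
    -- G c is the level weight of U ∷ c; words D ∷ c are never Dyck, hence the + 0.
    G : List Step → ℕ
    G c = δ (verticesAtLevel (suc s) (U ∷ c)) j
    X : List Step → List Step → ℕ
    X a b = 𝟙 (isDyck a) * (𝟙 (isDyck b) * G (a ++ D ∷ b))

  convolution : ∀ m K →
    sumTo j (λ k → Σʷ m (pWeight s k) * Σʷ K (pWeight (suc s) (j ∸ k))) ≡ pairCount m K
  convolution m K = begin
    sumTo j (λ k → Σʷ m (pWeight s k) * Σʷ K (pWeight (suc s) (j ∸ k)))
      ≡⟨ sumBelow-cong (suc j) (λ k → Σʷ-product m K _ _) ⟩
    sumTo j (λ k → Σʷ m (λ a → Σʷ K (λ b → pWeight s k a * pWeight (suc s) (j ∸ k) b)))
      ≡⟨ sumBelow-Σʷ (suc j) m _ ⟩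
    Σʷ m (λ a → sumTo j (λ k → Σʷ K (λ b → pWeight s k a * pWeight (suc s) (j ∸ k) b)))
      ≡⟨ Σʷ-cong m (λ a → sumBelow-Σʷ (suc j) K _) ⟩
    Σʷ m (λ a → Σʷ K (λ b → sumTo j (λ k → pWeight s k a * pWeight (suc s) (j ∸ k) b)))
      ≡⟨ Σʷ-cong m (λ a → Σʷ-cong K (λ b → weighted-convolution
           (𝟙 (isDyck a)) (𝟙 (isDyck b)) (verticesAtLevel s a) (verticesAtLevel (suc s) b) j)) ⟩
    Σʷ m (λ a → Σʷ K (λ b → 𝟙 (isDyck a) *
      (𝟙 (isDyck b) * δ (verticesAtLevel s a + verticesAtLevel (suc s) b) j)))
      ≡⟨ Σʷ-cong m (λ a → Σʷ-scale K (𝟙 (isDyck a)) _) ⟩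
    pairCount m K ∎

  rhs-term : ∀ n i →
    sumTo j (λ k → p i s k * p (n ∸ i) (suc s) (j ∸ k)) ≡ pairCount (2 * i) (2 * n ∸ 2 * i)
  rhs-term n i = begin
    sumTo j (λ k → p i s k * p (n ∸ i) (suc s) (j ∸ k))
      ≡⟨ sumBelow-cong (suc j) (λ k → cong₂ _*_ (p-as-Σʷ i s k) (p-as-Σʷ (n ∸ i) (suc s) (j ∸ k))) ⟩
    sumTo j (λ k → Σʷ (2 * i) (pWeight s k) * Σʷ (2 * (n ∸ i)) (pWeight (suc s) (j ∸ k)))
      ≡⟨ convolution (2 * i) (2 * (n ∸ i)) ⟩
    pairCount (2 * i) (2 * (n ∸ i))
      ≡⟨ cong (pairCount (2 * i)) (*-distribˡ-∸ 2 n i) ⟩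
    pairCount (2 * i) (2 * n ∸ 2 * i) ∎

  recurrence : ∀ n →
    p (suc n) (suc s) j ≡ sumBelow (suc n) (λ i → sumTo j (λ k → p i s k * p (n ∸ i) (suc s) (j ∸ k)))
  recurrence n = trans (lhs n) (sumBelow-cong (suc n) (λ i → sym (rhs-term n i)))

-- The empty path has its only vertex at height 0, so it is 0-ped at every
-- positive level; the recurrence is Recurrence.recurrence.
mainTheorem2 :
    ((s : ℕ) → p 0 (suc s) 0 ≡ 1)
    × ((s j : ℕ) → p 0 (suc s) (suc j) ≡ 0)
    × ((s n j : ℕ) →
        p (suc n) (suc s) j
          ≡ sumBelow (suc n) (λ i → sumTo j (λ k → p i s k * p (n ∸ i) (suc s) (j ∸ k))))
mainTheorem2 =
    (λ s → refl)
  , (λ s j → refl)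
  , (λ s n j → Recurrence.recurrence s j n)
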